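{- For any $t \in o(\sqrt{n})$, $\mathrm{DACA}(t) = \mathrm{DACA}(O(1))$.
   Context: A cellular automaton (CA) is $C=(Q,\delta,\Sigma)$ with finite state set $Q$, local rule $\delta\colon Q^3\to Q$, input alphabet $\Sigma\subseteq Q$, and an inactive state $q\in Q\setminus\Sigma$ with $\delta(z_1,z_2,z_3)=q$ iff $z_2=q$; the global map is $\Delta(c)(z)=\delta(c(z-1),c(z),c(z+1))$ on $Q^{\mathbb{Z}}$. For input $w\in\Sigma^+$ the initial configuration $c_0$ has $c_0(i)=w(i)$ for $0\le i<|w|$ and $q$ elsewhere. For $F\subseteq Q\setminus\{q\}$, a configuration $\Delta^\tau(c_0)$ is $F$-final if all its cells are in $F\cup\{q\}$. A decider ACA (DACA) is a CA with nonempty disjoint sets $A,R\subseteq Q\setminus\{q\}$ of accept and reject states such that every input $w\in\Sigma^+$ leads to an $A$-final or an $R$-final configuration; $C$ accepts $w$ if it reaches an $A$-final configuration with no earlier $R$-final configuration, and rejects $w$ if it reaches an $R$-final configuration with no earlier $A$-final one. The time taken on $w$ is the number of steps until the first $A$- or $R$-final configuration. $L(C)$ is the set of accepted words. For $t\colon\mathbb{N}_+\to\mathbb{N}_0$, $\mathrm{DACA}(t)$ is the class of $L(C)$ for DACAs deciding every input $w$ within $t(|w|)$ steps; $\mathrm{DACA}(O(1))$ is the union over constant $t$. -}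

module Defs where

open import Data.Nat using (ℕ; zero; suc; _≤_; _<_; _*_; _+_)
open import Data.Integer as ℤ using (ℤ; +_; -[1+_])
open import Data.Fin using (Fin)
open import Data.Fin.Subset using (Subset; _∈_; _∉_; Nonempty)
open import Data.List using (List; []; _∷_)
open import Data.List.NonEmpty using (List⁺; toList; length)
open import Data.Product using (Σ; ∃; ∃-syntax; _×_; _,_)
open import Data.Sum using (_⊎_)
open import Relation.Nullary using (¬_)
open import Data.Empty using (⊥)
open import Relation.Binary.PropositionalEquality using (_≡_; _≢_)
open import Function.Bundles using (_⇔_)
open import Function.Definitions using (Injective)

-- A cellular automaton over the input alphabet Σ = Fin m.
-- The state set is Q = Fin k; Σ ⊆ Q is given by an injective embedding `inp`.
record CA (m : ℕ) : Set where
  field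
    k       : ℕ
    δ       : Fin k → Fin k → Fin k → Fin k
    inp     : Fin m → Fin k
    inp-inj : Injective _≡_ _≡_ inp
    q       : Fin k
    q∉Σ     : ∀ a → inp a ≢ q
    δ-q     : ∀ x y z → (δ x y z ≡ q ⇔ y ≡ q)

  Config : Set
  Config = ℤ → Fin k

  Δ : Config → Config
  Δ c z = δ (c (z ℤ.- ℤ.1ℤ)) (c z) (c (z ℤ.+ ℤ.1ℤ))

  Δ^ : ℕ → Config → Config
  Δ^ zero    c = c
  Δ^ (suc τ) c = Δ (Δ^ τ c)

  readAt : List (Fin m) → ℕ → Fin k
  readAt []       _       = q
  readAt (a ∷ as) zero    = inp a
  readAt (a ∷ as) (suc i) = readAt as i

  init : List⁺ (Fin m) → Config
  init w (+ i)      = readAt (toList w) i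
  init w -[1+ _ ]   = q

  cfg : List⁺ (Fin m) → ℕ → Config
  cfg w τ = Δ^ τ (init w)

  Final : Subset k → Config → Set
  Final F c = ∀ z → c z ∈ F ⊎ c z ≡ q

record DACA (m : ℕ) : Set where
  field
    ca : CA m
  open CA ca public
  field
    A         : Subset k
    R         : Subset k
    A-nonempty : Nonempty A
    R-nonempty : Nonempty R
    disjoint  : ∀ x → x ∈ A → x ∈ R → ⊥
    q∉A       : q ∉ A
    q∉R       : q ∉ R
    decider   : ∀ w → ∃[ τ ] (Final A (cfg w τ) ⊎ Final R (cfg w τ))

  Accepts : List⁺ (Fin m) → Set
  Accepts w = ∃[ τ ] (Final A (cfg w τ) × (∀ τ' → τ' < τ → ¬ Final R (cfg w τ')))

  DecidesWithin : (ℕ → ℕ) → Set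
  DecidesWithin t = ∀ w → ∃[ τ ] (τ ≤ t (length w) × (Final A (cfg w τ) ⊎ Final R (cfg w τ)))

InDACA : (t : ℕ → ℕ) → {m : ℕ} → (L : List⁺ (Fin m) → Set) → Set
InDACA t {m} L = Σ (DACA m) λ C → DACA.DecidesWithin C t × (∀ w → DACA.Accepts C w ⇔ L w)

InDACA-O1 : {m : ℕ} → (L : List⁺ (Fin m) → Set) → Set
InDACA-O1 L = ∃[ c ] InDACA (λ _ → c) L

-- t ∈ o(√n):  for every ε = 1/c > 0 there is N with t(n) ≤ √n / c for all n ≥ N,
-- i.e. (c · t(n))² ≤ n.
LittleOSqrt : (ℕ → ℕ) → Set
LittleOSqrt t = ∀ c → ∃[ N ] (∀ n → N ≤ n → (suc c * t n) * (suc c * t n) ≤ n)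

-- Choose r with 3 t(n) ≤ √n for all n ≥ r. After s ≤ r steps a cell depends only on the
-- 2r + 1 input cells around it. Given an input w with |w| ≥ 2r + 1, pick for every s ≤ r and
-- each of A and R a cell witnessing, if there is one, that the configuration at time s is not
-- final, and cut w down to the word w' made of its first and last 2r + 1 letters and the
-- 2r + 1 letters around each witness. Then |w'| ≤ (2r + 4)(2r + 1) < (3(r + 1))², so w' is
-- decided at some time τ ≤ t(|w'|) ≤ r; as the witnesses survive in w', the configuration of
-- w at time τ is final too. Short inputs are decided within max {t(n) | n ≤ 2r} steps.
module Submission where

open import Defs
open import Data.Nat using (ℕ)
open import Data.Fin using (Fin)
open import Data.List.NonEmpty using (List⁺)

open import Data.Nat.Base using (zero; suc; _+_; _*_; _∸_; _≤_; _<_; z≤n; z<s; s≤s; s≤s⁻¹)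
open import Data.Nat.Properties
open import Data.Nat.Tactic.RingSolver using (solve-∀)
open import Data.Integer.Base as ℤ using (ℤ; +_; -[1+_]; _⊖_; ∣_∣)
import Data.Integer.Properties as ℤ
open import Data.Fin.Base using (toℕ; fromℕ<)
open import Data.Fin.Properties using (all?; ¬∀⟶∃¬; toℕ-fromℕ<) renaming (_≟_ to _≟ᶠ_)
open import Data.Fin.Subset using (Subset; _∈_)
open import Data.Fin.Subset.Properties using (_∈?_)
open import Data.List.Base as List using (List; []; _∷_; _++_; take; drop; concatMap; applyUpTo)
open import Data.List.Membership.Propositional using () renaming (_∈_ to _∈ₗ_)
open import Data.List.Membership.Propositional.Properties using (∈-++⁺ˡ; ∈-++⁺ʳ; ∈-applyUpTo⁺)
import Data.List.Relation.Unary.All as All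
open import Data.List.Extrema.Nat using (max; xs≤max)
open import Data.List.Relation.Unary.Any using (here; there)
open import Data.List.Properties
  using (length-++; length-take; length-drop; length-applyUpTo; ++-assoc; length-++-≤ˡ)
open import Data.List.NonEmpty.Base using (toList; head; tail; length; _∷_)
open import Data.Product.Base using (∃; ∃₂; _×_; _,_; proj₁; proj₂)
open import Data.Sum.Base as Sum using (_⊎_; inj₁; inj₂; fromInj₁)
open import Data.Empty using (⊥-elim)
open import Function.Bundles using (Equivalence)
open import Function.Nary.NonDependent using (congₙ)
open import Relation.Nullary using (¬_; Dec; yes; no)
open import Relation.Nullary.Decidable using (_⊎-dec_)
open import Relation.Binary.PropositionalEquality

concatMap-∈ : ∀ {A B : Set} (f : A → List B) {x xs} → x ∈ₗ xs →
              ∃₂ λ ys zs → concatMap f xs ≡ ys ++ f x ++ zs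
concatMap-∈ f {xs = _ ∷ xs} (here refl)  = [] , concatMap f xs , refl
concatMap-∈ f {xs = y ∷ _}  (there x∈xs) =
  let ys , zs , eq = concatMap-∈ f x∈xs
  in f y ++ ys , zs , trans (cong (f y ++_) eq) (sym (++-assoc (f y) ys _))

length-concatMap-≤ : ∀ {A B : Set} {b} (f : A → List B) → (∀ x → List.length (f x) ≤ b) →
                     ∀ xs → List.length (concatMap f xs) ≤ List.length xs * b
length-concatMap-≤ f f≤b []       = z≤n
length-concatMap-≤ f f≤b (x ∷ xs) = begin
  List.length (f x ++ concatMap f xs)
    ≡⟨ length-++ (f x) ⟩
  List.length (f x) + List.length (concatMap f xs)
    ≤⟨ +-mono-≤ (f≤b x) (length-concatMap-≤ f f≤b xs) ⟩
  _ + List.length xs * _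
    ∎
  where open ≤-Reasoning

module CellularAutomaton {m : ℕ} (C : CA m) where
  open CA C

  FinalState : Subset k → Fin k → Set
  FinalState F x = x ∈ F ⊎ x ≡ q

  finalState? : ∀ F x → Dec (FinalState F x)
  finalState? F x = (x ∈? F) ⊎-dec (x ≟ᶠ q)

  record Agree (r : ℕ) (c c' : Config) (z z' : ℤ) : Set where
    constructor agree
    field
      cells : ∀ d → ∣ d ∣ ≤ r → c (z ℤ.+ d) ≡ c' (z' ℤ.+ d)
  open Agree

  Agree-mono : ∀ {r r' c c' z z'} → r ≤ r' → Agree r' c c' z z' → Agree r c c' z z'
  Agree-mono r≤r' a = agree λ d ∣d∣≤r → cells a d (≤-trans ∣d∣≤r r≤r')

  Agree-shift : ∀ {r c c' z z'} e → ∣ e ∣ ≤ 1 →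
                Agree (suc r) c c' z z' → Agree r c c' (z ℤ.+ e) (z' ℤ.+ e)
  Agree-shift {c = c} {c'} {z} {z'} e ∣e∣≤1 a = agree λ d ∣d∣≤r →
    subst₂ (λ x y → c x ≡ c' y) (sym (ℤ.+-assoc z e d)) (sym (ℤ.+-assoc z' e d))
      (cells a (e ℤ.+ d) (≤-trans (ℤ.∣i+j∣≤∣i∣+∣j∣ e d) (+-mono-≤ ∣e∣≤1 ∣d∣≤r)))

  Δ^-local : ∀ s {c c' z z'} → Agree s c c' z z' → Δ^ s c z ≡ Δ^ s c' z'
  Δ^-local zero {c} {c'} {z} {z'} a =
    subst₂ (λ x y → c x ≡ c' y) (ℤ.+-identityʳ z) (ℤ.+-identityʳ z') (cells a (+ 0) z≤n)
  Δ^-local (suc s) a = congₙ 3 δ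
    (Δ^-local s (Agree-shift ℤ.-1ℤ ≤-refl a))
    (Δ^-local s (Agree-mono (n≤1+n s) a))
    (Δ^-local s (Agree-shift ℤ.1ℤ ≤-refl a))

  Δ^-inactive : ∀ s {c z} → c z ≡ q → Δ^ s c z ≡ q
  Δ^-inactive zero    c[z]≡q = c[z]≡q
  Δ^-inactive (suc s) c[z]≡q = Equivalence.from (δ-q _ _ _) (Δ^-inactive s c[z]≡q)

  readAt-≥ : ∀ xs {i} → List.length xs ≤ i → readAt xs i ≡ q
  readAt-≥ []       _             = refl
  readAt-≥ (x ∷ xs) (s≤s len≤i) = readAt-≥ xs len≤i

  readAt-++ˡ : ∀ xs {ys i} → i < List.length xs → readAt (xs ++ ys) i ≡ readAt xs i
  readAt-++ˡ (x ∷ xs) {i = zero}  _           = refl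
  readAt-++ˡ (x ∷ xs) {i = suc i} (s≤s i<len) = readAt-++ˡ xs i<len

  readAt-++ʳ : ∀ xs {ys} i → readAt (xs ++ ys) (List.length xs + i) ≡ readAt ys i
  readAt-++ʳ []       i = refl
  readAt-++ʳ (x ∷ xs) i = readAt-++ʳ xs i

  readAt-take : ∀ n xs {i} → i < n → readAt (take n xs) i ≡ readAt xs i
  readAt-take (suc n) []                 _         = refl
  readAt-take (suc n) (x ∷ xs) {zero}  _         = refl
  readAt-take (suc n) (x ∷ xs) {suc i} (s≤s i<n) = readAt-take n xs i<n

  readAt-drop : ∀ n xs i → readAt (drop n xs) i ≡ readAt xs (n + i)
  readAt-drop zero    xs       i = refl
  readAt-drop (suc n) []       i = refl
  readAt-drop (suc n) (x ∷ xs) i = readAt-drop n xs i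

  init-⊖ : ∀ w {j e} → j ≤ e → init w (j ⊖ suc e) ≡ q
  init-⊖ w {zero}          _         = refl
  init-⊖ w {suc j} {suc e} (s≤s j≤e) =
    trans (cong (init w) (ℤ.[1+m]⊖[1+n]≡m⊖n j (suc e))) (init-⊖ w j≤e)

  final-from-word-cells : ∀ F w s → (∀ (i : Fin (length w)) → FinalState F (cfg w s (+ toℕ i))) →
                          Final F (cfg w s)
  final-from-word-cells F w s cells -[1+ _ ] = inj₂ (Δ^-inactive s refl)
  final-from-word-cells F w s cells (+ i) with i <? length w
  ... | yes i<n = subst (λ j → FinalState F (cfg w s (+ j))) (toℕ-fromℕ< i<n) (cells (fromℕ< i<n))
  ... | no  i≮n = inj₂ (Δ^-inactive s (readAt-≥ (toList w) (≮⇒≥ i≮n)))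

  final-or-witness : ∀ F w s → ∃ λ p → Final F (cfg w s) ⊎ ¬ FinalState F (cfg w s (+ p))
  final-or-witness F w s = decide (all? cell?)
    where
    cell? : ∀ (i : Fin (length w)) → Dec (FinalState F (cfg w s (+ toℕ i)))
    cell? i = finalState? F (cfg w s (+ toℕ i))
    decide : Dec (∀ i → FinalState F (cfg w s (+ toℕ i))) →
             ∃ λ p → Final F (cfg w s) ⊎ ¬ FinalState F (cfg w s (+ p))
    decide (yes cells) = 0 , inj₁ (final-from-word-cells F w s cells)
    decide (no ¬cells) = let i , bad = ¬∀⟶∃¬ (length w) _ cell? ¬cells in toℕ i , inj₂ bad

  -- A window reaching left of cell 0 sees q there, so it is matched only when both factors
  -- start their words.
  init-agree : ∀ u v a a' j r →
               (∀ i → i ≤ j + r → readAt (toList u) (a + i) ≡ readAt (toList v) (a' + i)) →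
               (j < r → a ≡ 0 × a' ≡ 0) →
               Agree r (init u) (init v) (+ (a + j)) (+ (a' + j))
  init-agree u v a a' j r same edge = agree cell
    where
    cell : ∀ d → ∣ d ∣ ≤ r → init u (+ (a + j) ℤ.+ d) ≡ init v (+ (a' + j) ℤ.+ d)
    cell (+ e) e≤r = begin
      readAt (toList u) (a + j + e)    ≡⟨ cong (readAt (toList u)) (+-assoc a j e) ⟩
      readAt (toList u) (a + (j + e))  ≡⟨ same (j + e) (+-monoʳ-≤ j e≤r) ⟩
      readAt (toList v) (a' + (j + e)) ≡⟨ cong (readAt (toList v)) (+-assoc a' j e) ⟨
      readAt (toList v) (a' + j + e)   ∎
      where open ≡-Reasoning
    cell -[1+ e ] e<r with suc e ≤? j
    ... | yes e<j = begin
      init u ((a + j) ⊖ suc e)              ≡⟨ cong (init u) (⊖-within a) ⟩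
      readAt (toList u) (a + (j ∸ suc e))   ≡⟨ same (j ∸ suc e) j∸[1+e]≤j+r ⟩
      readAt (toList v) (a' + (j ∸ suc e))  ≡⟨ cong (init v) (⊖-within a') ⟨
      init v ((a' + j) ⊖ suc e)             ∎
      where
      open ≡-Reasoning
      ⊖-within : ∀ b → (b + j) ⊖ suc e ≡ + (b + (j ∸ suc e))
      ⊖-within b = trans (ℤ.⊖-≥ (≤-trans e<j (m≤n+m j b))) (cong +_ (+-∸-assoc b e<j))
      j∸[1+e]≤j+r : j ∸ suc e ≤ j + r
      j∸[1+e]≤j+r = ≤-trans (m∸n≤m j (suc e)) (m≤m+n j r)
    ... | no e≮j with refl , refl ← edge (<-≤-trans (≰⇒> e≮j) e<r) =
      trans (init-⊖ u j≤e) (sym (init-⊖ v j≤e))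
      where
      j≤e : j ≤ e
      j≤e = s≤s⁻¹ (≰⇒> e≮j)

module Compression {m : ℕ} (C : CA m) (r : ℕ) where
  open CA C
  open CellularAutomaton C

  width : ℕ
  width = suc (r + r)

  factor : List⁺ (Fin m) → ℕ → List (Fin m)
  factor w p = take width (drop (p ∸ r) (toList w))

  -- The first width letters of w, the width letters around each p ∈ ps, and the last width
  -- letters of w; the first block is spelt out via head and tail to make the result nonempty.
  compress : List⁺ (Fin m) → List ℕ → List⁺ (Fin m)
  compress w ps =
    head w ∷ take (r + r) (tail w) ++ concatMap (factor w) ps ++ drop (length w ∸ width) (toList w)

  module _ (w : List⁺ (Fin m)) (ps : List ℕ) where
    private
      n = length w
      prefix = take width (toList w)
      middle = concatMap (factor w) ps
      suffix = drop (n ∸ width) (toList w)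
      w' = compress w ps

    length-compress-≤ : length w' ≤ (2 + List.length ps) * width
    length-compress-≤ = begin
      List.length (prefix ++ middle ++ suffix)
        ≡⟨ length-++ prefix ⟩
      List.length prefix + List.length (middle ++ suffix)
        ≡⟨ cong (λ x → List.length prefix + x) (length-++ middle) ⟩
      List.length prefix + (List.length middle + List.length suffix)
        ≤⟨ +-mono-≤ prefix≤ (+-mono-≤ middle≤ suffix≤) ⟩
      width + (List.length ps * width + width)
        ≡⟨ cong (λ x → width + x) (+-comm _ width) ⟩
      (2 + List.length ps) * width
        ∎
      where
      open ≤-Reasoning
      prefix≤ : List.length prefix ≤ width
      prefix≤ = subst (_≤ width) (sym (length-take width (toList w))) (m⊓n≤m width n)
      middle≤ : List.length middle ≤ List.length ps * width
      middle≤ = length-concatMap-≤ (factor w) factor≤ ps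
        where
        factor≤ : ∀ p → List.length (factor w p) ≤ width
        factor≤ p = subst (_≤ width) (sym (length-take width (drop (p ∸ r) (toList w)))) (m⊓n≤m width _)
      suffix≤ : List.length suffix ≤ width
      suffix≤ = subst (_≤ width) (sym (length-drop (n ∸ width) (toList w)))
        (m≤n+o⇒m∸n≤o n (n ∸ width) (subst (n ≤_) (+-comm width (n ∸ width)) (m≤n+m∸n n width)))

    module _ (long : width ≤ n) where
      private
        length-prefix : List.length prefix ≡ width
        length-prefix = trans (length-take width (toList w)) (m≤n⇒m⊓n≡m long)

      width≤length-compress : width ≤ length w'
      width≤length-compress = subst (_≤ length w') length-prefix (length-++-≤ˡ prefix)

      left-edge-agree : ∀ {p} → p ≤ r → Agree r (init w) (init w') (+ p) (+ p)
      left-edge-agree {p} p≤r = init-agree w w' 0 0 p r same (λ _ → refl , refl)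
        where
        same : ∀ i → i ≤ p + r → readAt (toList w) i ≡ readAt (toList w') i
        same i i≤p+r = sym (trans (readAt-++ˡ prefix (subst (i <_) (sym length-prefix) i<width))
                                  (readAt-take width (toList w) i<width))
          where
          i<width : i < width
          i<width = s≤s (≤-trans i≤p+r (+-monoˡ-≤ r p≤r))

      interior-agree : ∀ {p} → r < p → p + r < n → p ∈ₗ ps →
                       ∃ λ p' → Agree r (init w) (init w') (+ p) (+ p')
      interior-agree {p} r<p p+r<n p∈ps with ys , zs , middle≡ ← concatMap-∈ (factor w) p∈ps =
        a' + r , subst (λ x → Agree r (init w) (init w') (+ x) (+ (a' + r))) (m∸n+n≡m (<⇒≤ r<p))
                       (init-agree w w' (p ∸ r) a' r r same (λ r<r → ⊥-elim (<-irrefl refl r<r)))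
        where
        open ≡-Reasoning
        a' = List.length (prefix ++ ys)
        split : toList w' ≡ (prefix ++ ys) ++ factor w p ++ zs ++ suffix
        split = begin
          prefix ++ middle ++ suffix
            ≡⟨ cong (λ xs → prefix ++ xs ++ suffix) middle≡ ⟩
          prefix ++ (ys ++ factor w p ++ zs) ++ suffix
            ≡⟨ cong (prefix ++_) (++-assoc ys _ suffix) ⟩
          prefix ++ ys ++ (factor w p ++ zs) ++ suffix
            ≡⟨ cong (λ xs → prefix ++ ys ++ xs) (++-assoc (factor w p) zs suffix) ⟩
          prefix ++ ys ++ factor w p ++ zs ++ suffix
            ≡⟨ ++-assoc prefix ys _ ⟨
          (prefix ++ ys) ++ factor w p ++ zs ++ suffix
            ∎
        fits : width + (p ∸ r) ≡ suc (p + r)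
        fits = cong suc (begin
          r + r + (p ∸ r)   ≡⟨ +-assoc r r (p ∸ r) ⟩
          r + (r + (p ∸ r)) ≡⟨ cong (λ x → r + x) (m+[n∸m]≡n (<⇒≤ r<p)) ⟩
          r + p             ≡⟨ +-comm r p ⟩
          p + r             ∎)
        length-factor : List.length (factor w p) ≡ width
        length-factor = trans (length-take width (drop (p ∸ r) (toList w))) (m≤n⇒m⊓n≡m
          (subst (width ≤_) (sym (length-drop (p ∸ r) (toList w)))
            (m+n≤o⇒m≤o∸n width (subst (_≤ n) (sym fits) p+r<n))))
        same : ∀ i → i ≤ r + r → readAt (toList w) (p ∸ r + i) ≡ readAt (toList w') (a' + i)
        same i i≤2r = sym (begin
          readAt (toList w') (a' + i)
            ≡⟨ cong (λ xs → readAt xs (a' + i)) split ⟩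
          readAt ((prefix ++ ys) ++ factor w p ++ zs ++ suffix) (a' + i)
            ≡⟨ readAt-++ʳ (prefix ++ ys) i ⟩
          readAt (factor w p ++ zs ++ suffix) i
            ≡⟨ readAt-++ˡ (factor w p) i<|factor| ⟩
          readAt (factor w p) i
            ≡⟨ readAt-take width (drop (p ∸ r) (toList w)) (s≤s i≤2r) ⟩
          readAt (drop (p ∸ r) (toList w)) i
            ≡⟨ readAt-drop (p ∸ r) (toList w) i ⟩
          readAt (toList w) (p ∸ r + i)
            ∎)
          where
          i<|factor| : i < List.length (factor w p)
          i<|factor| = subst (i <_) (sym length-factor) (s≤s i≤2r)

      right-edge-agree : ∀ {p} → n ≤ p + r → ∃ λ p' → Agree r (init w) (init w') (+ p) (+ p')
      right-edge-agree {p} n≤p+r =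
        a' + j , subst (λ x → Agree r (init w) (init w') (+ x) (+ (a' + j))) (m+[n∸m]≡n a≤p)
                       (init-agree w w' a a' j r same edge)
        where
        a = n ∸ width
        a' = List.length (prefix ++ middle)
        j = p ∸ a
        a≤p : a ≤ p
        a≤p = m≤n+o⇒m∸n≤o n width (≤-trans n≤p+r
          (subst (p + r ≤_) (+-comm p width) (+-monoʳ-≤ p (≤-trans (m≤m+n r r) (n≤1+n _)))))
        same : ∀ i → i ≤ j + r → readAt (toList w) (a + i) ≡ readAt (toList w') (a' + i)
        same i _ = sym (begin
          readAt (toList w') (a' + i)
            ≡⟨ cong (λ xs → readAt xs (a' + i)) (++-assoc prefix middle suffix) ⟨
          readAt ((prefix ++ middle) ++ suffix) (a' + i)  ≡⟨ readAt-++ʳ (prefix ++ middle) i ⟩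
          readAt suffix i                                 ≡⟨ readAt-drop a (toList w) i ⟩
          readAt (toList w) (a + i)                       ∎)
          where open ≡-Reasoning
        edge : j < r → a ≡ 0 × a' ≡ 0
        edge j<r = ⊥-elim (<⇒≱ p+r<n n≤p+r)
          where
          open ≤-Reasoning
          p+r<n : p + r < n
          p+r<n = begin-strict
            p + r        ≡⟨ cong (λ x → x + r) (m+[n∸m]≡n a≤p) ⟨
            a + j + r    ≡⟨ +-assoc a j r ⟩
            a + (j + r)  <⟨ +-monoʳ-< a (m<n⇒m<1+n (+-monoˡ-< r j<r)) ⟩
            a + width    ≡⟨ m∸n+n≡m long ⟩
            n            ∎

      compress-agree : ∀ {p} → p ∈ₗ ps → ∃ λ p' → Agree r (init w) (init w') (+ p) (+ p')
      compress-agree {p} p∈ps with p ≤? r | p + r <? n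
      ... | yes p≤r | _          = p , left-edge-agree p≤r
      ... | no  p≰r | yes p+r<n  = interior-agree (≰⇒> p≰r) p+r<n p∈ps
      ... | no  _   | no  p+r≮n  = right-edge-agree (≮⇒≥ p+r≮n)

      compress-preserves-nonfinal : ∀ {F p s} → p ∈ₗ ps → s ≤ r →
                                    ¬ FinalState F (cfg w s (+ p)) → ¬ Final F (cfg w' s)
      compress-preserves-nonfinal {F} p∈ps s≤r nonfinal final' =
        let p' , agreement = compress-agree p∈ps
            same-state = Δ^-local _ (Agree-mono s≤r agreement)
        in nonfinal (subst (FinalState F) (sym same-state) (final' (+ p')))

t≤r-below-square : ∀ {t : ℕ → ℕ} c {r n} → (∀ n → r ≤ n → suc c * t n * (suc c * t n) ≤ n) →
                    r ≤ n → n < suc c * suc r * (suc c * suc r) → t n ≤ r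
t≤r-below-square {t} c {r} {n} bound r≤n n<[c+1][r+1]² = ≮⇒≥ λ r<t[n] →
  <⇒≱ n<[c+1][r+1]²
    (≤-trans (*-mono-≤ (*-monoʳ-≤ (suc c) r<t[n]) (*-monoʳ-≤ (suc c) r<t[n])) (bound n r≤n))

module Decider {m : ℕ} (D : DACA m) where
  open DACA D
  open CellularAutomaton ca

  module _ (r : ℕ) (w : List⁺ (Fin m)) where
    open Compression ca r

    witness : Subset k → ℕ → ℕ
    witness F s = proj₁ (final-or-witness F w s)

    witnesses-of : Subset k → List ℕ
    witnesses-of F = applyUpTo (witness F) (suc r)

    witnesses : List ℕ
    witnesses = witnesses-of A ++ witnesses-of R

    compressed : List⁺ (Fin m)
    compressed = compress w witnesses

    length-compressed< : length compressed < 3 * suc r * (3 * suc r)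
    length-compressed< = begin-strict
      length compressed
        ≤⟨ length-compress-≤ w witnesses ⟩
      (2 + List.length witnesses) * width
        ≡⟨ cong (λ l → (2 + l) * width) length-witnesses ⟩
      (2 + (suc r + suc r)) * width
        <⟨ m<m+n _ z<s ⟩
      (2 + (suc r + suc r)) * width + suc (5 * r * r + 8 * r + 4)
        ≡⟨ expand r ⟩
      3 * suc r * (3 * suc r)
        ∎
      where
      open ≤-Reasoning
      length-witnesses : List.length witnesses ≡ suc r + suc r
      length-witnesses = trans (length-++ (witnesses-of A))
        (cong₂ _+_ (length-applyUpTo (witness A) (suc r)) (length-applyUpTo (witness R) (suc r)))
      expand : ∀ r → (2 + (suc r + suc r)) * suc (r + r) + suc (5 * r * r + 8 * r + 4)
                   ≡ 3 * suc r * (3 * suc r)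
      expand = solve-∀

    module _ (long : width ≤ length w) where
      final-pulls-back : ∀ {F s} → s ≤ r → witness F s ∈ₗ witnesses →
                         Final F (cfg compressed s) → Final F (cfg w s)
      final-pulls-back {F} {s} s≤r ∈witnesses final' = fromInj₁
        (λ nonfinal → ⊥-elim
          (compress-preserves-nonfinal w witnesses long ∈witnesses s≤r nonfinal final'))
        (proj₂ (final-or-witness F w s))

      decision-pulls-back : ∀ {s} → s ≤ r →
                            Final A (cfg compressed s) ⊎ Final R (cfg compressed s) →
                            Final A (cfg w s) ⊎ Final R (cfg w s)
      decision-pulls-back s≤r = Sum.map
        (final-pulls-back s≤r (∈-++⁺ˡ {ys = witnesses-of R} (∈-applyUpTo⁺ (witness A) (s≤s s≤r))))
        (final-pulls-back s≤r (∈-++⁺ʳ (witnesses-of A) (∈-applyUpTo⁺ (witness R) (s≤s s≤r))))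

      r≤length-compressed : r ≤ length compressed
      r≤length-compressed =
        ≤-trans (≤-trans (m≤m+n r r) (n≤1+n _)) (width≤length-compress w witnesses long)

  long-inputs-decided-within : ∀ {t} r → DecidesWithin t →
    (∀ n → r ≤ n → 3 * t n * (3 * t n) ≤ n) →
    ∀ w → suc (r + r) ≤ length w → ∃ λ τ → τ ≤ r × (Final A (cfg w τ) ⊎ Final R (cfg w τ))
  long-inputs-decided-within {t} r decides bound w long =
    let τ , τ≤t , decided = decides (compressed r w)
        τ≤r = ≤-trans τ≤t
          (t≤r-below-square {t} 2 bound (r≤length-compressed r w long) (length-compressed< r w))
    in τ , τ≤r , decision-pulls-back r w long τ≤r decided

theorem9 : (t : ℕ → ℕ) → LittleOSqrt t →
    (m : ℕ) (L : List⁺ (Fin m) → Set) → InDACA t L → InDACA-O1 L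
theorem9 t o[√n] m L (D , decides , accepts) =
  r + max 0 (applyUpTo t width) , D , decides-in-constant-time , accepts
  where
  open DACA D
  r = proj₁ (o[√n] 2)
  width = suc (r + r)
  t≤max : ∀ {n} → n < width → t n ≤ max 0 (applyUpTo t width)
  t≤max n<width = All.lookup (xs≤max 0 (applyUpTo t width)) (∈-applyUpTo⁺ t n<width)
  decides-in-constant-time : DecidesWithin (λ _ → r + max 0 (applyUpTo t width))
  decides-in-constant-time w with width ≤? length w
  ... | yes long =
    let τ , τ≤r , decided =
          Decider.long-inputs-decided-within D {t} r decides (proj₂ (o[√n] 2)) w long
    in τ , ≤-trans τ≤r (m≤m+n r _) , decided
  ... | no short =
    let τ , τ≤t , decided = decides w
    in τ , ≤-trans τ≤t (≤-trans (t≤max (≰⇒> short)) (m≤n+m _ r)) , decided
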